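{- Every atomic flow is the atomic flow associated with some $\mathsf{SKS}$ derivation.
   Context: Formulae are built from units $\mathsf f$, $\mathsf t$, atoms $a$ (with a non-identical involution $a\mapsto\bar a$), disjunction $[\alpha\vee\beta]$ and conjunction $(\alpha\wedge\beta)$. An inference step rewrites $\xi\{\alpha\}$ to $\xi\{\beta\}$ for a context $\xi\{\ \}$ and an instance $\alpha\to\beta$ of an $\mathsf{SKS}$ rule: $\mathsf{ai}{\downarrow}\colon\mathsf t\to[a\vee\bar a]$, $\mathsf{aw}{\downarrow}\colon\mathsf f\to a$, $\mathsf{ac}{\downarrow}\colon[a\vee a]\to a$, $\mathsf{ai}{\uparrow}\colon(a\wedge\bar a)\to\mathsf f$, $\mathsf{aw}{\uparrow}\colon a\to\mathsf t$, $\mathsf{ac}{\uparrow}\colon a\to(a\wedge a)$, switch $\mathsf s\colon(\alpha\wedge[\beta\vee\gamma])\to[(\alpha\wedge\beta)\vee\gamma]$, medial $\mathsf m\colon[(\alpha\wedge\beta)\vee(\gamma\wedge\delta)]\to([\alpha\vee\gamma]\wedge[\beta\vee\delta])$, and $=$ (either direction of commutativity/associativity of $\vee,\wedge$, $[\alpha\vee\mathsf f]=\alpha$, $(\alpha\wedge\mathsf t)=\alpha$, $[\mathsf t\vee\mathsf t]=\mathsf t$, $(\mathsf f\wedge\mathsf f)=\mathsf f$). A derivation is a finite sequence of formulae, consecutive ones related by an inference step. An atomic flow is a finite directed graph with vertex set $V$, each vertex labelled by one of $\mathsf{ai}{\downarrow}$, $\mathsf{ai}{\uparrow}$, $\mathsf{aw}{\downarrow}$,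 $\mathsf{aw}{\uparrow}$, $\mathsf{ac}{\downarrow}$, $\mathsf{ac}{\uparrow}$, and edge set $E$, each edge having an upper end in $V\cup\{\top\}$ and a lower end in $V\cup\{\bot\}$ ($\top,\bot\notin V$). For a vertex $\nu$, its upper edges are those with lower end $\nu$ and its lower edges those with upper end $\nu$; the numbers (upper, lower) must be $(0,2)$ for $\mathsf{ai}{\downarrow}$, $(2,0)$ for $\mathsf{ai}{\uparrow}$, $(0,1)$ for $\mathsf{aw}{\downarrow}$, $(1,0)$ for $\mathsf{aw}{\uparrow}$, $(2,1)$ for $\mathsf{ac}{\downarrow}$, $(1,2)$ for $\mathsf{ac}{\uparrow}$. There is no directed cycle of edges, and there exists a polarity assignment $\pi\colon E\to\{+,-\}$ such that all edges of an $\mathsf{ac}{\downarrow}$ or $\mathsf{ac}{\uparrow}$ vertex have the same polarity and the two edges of an $\mathsf{ai}{\downarrow}$ or $\mathsf{ai}{\uparrow}$ vertex have different polarities. Flows are considered up to isomorphism. The atomic flow associated with a derivation $\Phi$ is the unique (up to isomorphism) atomic flow with a surjection from atom occurrences of $\Phi$ to its edges such that: for each inference step, atom occurrences in the context, and (for steps of $\mathsf s$, $\mathsf m$, $=$) occurrences inside the metavariables $\alpha,\beta,\gamma,\delta$, are mapped to the same edges as the corresponding occurrences in the next formula; each step of $\mathsf{ai}{\downarrow},\mathsf{ai}{\uparrow},\mathsf{aw}{\downarrow},\mathsf{aw}{\uparrow},\mathsf{ac}{\downarrow},\mathsf{ac}{\uparrow}$ corresponds to a vertex with the same label whose upper edges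 are the atom occurrences of the rule's premiss and lower edges those of its conclusion (e.g. for $\mathsf{ac}{\downarrow}$, upper edges are the two $a$'s of $[a\vee a]$, the lower edge the resulting $a$). The occurrences in the premiss of $\Phi$ are the upper edges (upper end $\top$) and those in the conclusion the lower edges (lower end $\bot$). -}

module Defs where

open import Data.Nat using (ℕ; zero; suc)
open import Data.Fin using (Fin; zero; suc; inject₁; fromℕ; _≟_)
open import Data.Maybe using (Maybe; just; nothing)
import Data.Maybe.Properties as MaybeP
open import Data.Bool using (Bool; true; false)
open import Data.Empty using (⊥)
open import Data.Unit using (⊤)
open import Data.Sum using (_⊎_; inj₁; inj₂)
open import Data.Product using (Σ; ∃; _×_; _,_)
open import Relation.Nullary using (¬_; does)
open import Relation.Binary.PropositionalEquality using (_≡_; _≢_)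

countF : ∀ {n} → (Fin n → Bool) → ℕ
countF {zero}  P = zero
countF {suc n} P with P zero
... | true  = suc (countF (λ i → P (suc i)))
... | false = countF (λ i → P (suc i))

IsBij : ∀ {X Y : Set} → (X → Y) → Set
IsBij {X} {Y} f = (∀ x y → f x ≡ f y → x ≡ y) × (∀ y → ∃ λ x → f x ≡ y)

BijOnto : ∀ {X Y : Set} → (X → Y) → (Y → Set) → Set
BijOnto {X} {Y} f P =
  (∀ x → P (f x)) × (∀ x y → f x ≡ f y → x ≡ y) × (∀ y → P y → ∃ λ x → f x ≡ y)

data Label : Set where
  ai↓ ai↑ aw↓ aw↑ ac↓ ac↑ : Label

upArity : Label → ℕ
upArity ai↓ = 0
upArity ai↑ = 2
upArity aw↓ = 0
upArity aw↑ = 1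
upArity ac↓ = 2
upArity ac↑ = 1

lowArity : Label → ℕ
lowArity ai↓ = 2
lowArity ai↑ = 0
lowArity aw↓ = 1
lowArity aw↑ = 0
lowArity ac↓ = 1
lowArity ac↑ = 2

-- Vertices are Fin nV, edges Fin nE.  An end 'nothing' means ⊤ (for the
-- upper end) resp. ⊥ (for the lower end).
record Flow : Set where
  field
    nV    : ℕ
    nE    : ℕ
    label : Fin nV → Label
    upper : Fin nE → Maybe (Fin nV)
    lower : Fin nE → Maybe (Fin nV)

data Polarity : Set where
  + - : Polarity

module _ (F : Flow) where
  open Flow F

  -- number of upper edges of ν (edges whose lower end is ν)
  #upperEdges : Fin nV → ℕ
  #upperEdges ν = countF (λ e → does (MaybeP.≡-dec _≟_ (lower e) (just ν)))

  -- number of lower edges of ν (edges whose upper end is ν)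
  #lowerEdges : Fin nV → ℕ
  #lowerEdges ν = countF (λ e → does (MaybeP.≡-dec _≟_ (upper e) (just ν)))

  data Reach : Fin nV → Fin nV → Set where
    edge : ∀ {ν μ} (e : Fin nE) → upper e ≡ just ν → lower e ≡ just μ → Reach ν μ
    _⨾_  : ∀ {ν μ κ} → Reach ν μ → Reach μ κ → Reach ν κ

  Incident : Fin nE → Fin nV → Set
  Incident e ν = (upper e ≡ just ν) ⊎ (lower e ≡ just ν)

  IsAC : Label → Set
  IsAC l = (l ≡ ac↓) ⊎ (l ≡ ac↑)

  IsAI : Label → Set
  IsAI l = (l ≡ ai↓) ⊎ (l ≡ ai↑)

  PolarityAssignment : (Fin nE → Polarity) → Set
  PolarityAssignment π =
    ∀ ν e e' → Incident e ν → Incident e' ν →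
      (IsAC (label ν) → π e ≡ π e') ×
      (IsAI (label ν) → e ≢ e' → π e ≢ π e')

  IsAtomicFlow : Set
  IsAtomicFlow =
    (∀ ν → (#upperEdges ν ≡ upArity (label ν)) × (#lowerEdges ν ≡ lowArity (label ν))) ×
    (∀ ν → ¬ Reach ν ν) ×
    (∃ λ π → PolarityAssignment π)

module Syntax (A : Set) (bar : A → A) where

  infixr 6 _∨_
  infixr 7 _∧_

  data Formula : Set where
    𝕗 𝕥  : Formula
    atom : A → Formula
    _∨_  : Formula → Formula → Formula
    _∧_  : Formula → Formula → Formula

  data Pos : Formula → Set where
    here : ∀ {a} → Pos (atom a)
    inl  : ∀ {α β} → Pos α → Pos (α ∨ β)
    inr  : ∀ {α β} → Pos β → Pos (α ∨ β)
    cl   : ∀ {α β} → Pos α → Pos (α ∧ β)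
    cr   : ∀ {α β} → Pos β → Pos (α ∧ β)

  data Ctx : Set where
    □    : Ctx
    _∨ₗ_ : Ctx → Formula → Ctx
    _∨ᵣ_ : Formula → Ctx → Ctx
    _∧ₗ_ : Ctx → Formula → Ctx
    _∧ᵣ_ : Formula → Ctx → Ctx

  plug : Ctx → Formula → Formula
  plug □ α = α
  plug (ξ ∨ₗ ψ) α = plug ξ α ∨ ψ
  plug (ψ ∨ᵣ ξ) α = ψ ∨ plug ξ α
  plug (ξ ∧ₗ ψ) α = plug ξ α ∧ ψ
  plug (ψ ∧ᵣ ξ) α = ψ ∧ plug ξ α

  CPos : Ctx → Set
  CPos □ = ⊥
  CPos (ξ ∨ₗ ψ) = CPos ξ ⊎ Pos ψ
  CPos (ψ ∨ᵣ ξ) = Pos ψ ⊎ CPos ξ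
  CPos (ξ ∧ₗ ψ) = CPos ξ ⊎ Pos ψ
  CPos (ψ ∧ᵣ ξ) = Pos ψ ⊎ CPos ξ

  ctxPos : ∀ {α} (ξ : Ctx) → CPos ξ → Pos (plug ξ α)
  ctxPos □ ()
  ctxPos (ξ ∨ₗ ψ) (inj₁ c) = inl (ctxPos ξ c)
  ctxPos (ξ ∨ₗ ψ) (inj₂ p) = inr p
  ctxPos (ψ ∨ᵣ ξ) (inj₁ p) = inl p
  ctxPos (ψ ∨ᵣ ξ) (inj₂ c) = inr (ctxPos ξ c)
  ctxPos (ξ ∧ₗ ψ) (inj₁ c) = cl (ctxPos ξ c)
  ctxPos (ξ ∧ₗ ψ) (inj₂ p) = cr p
  ctxPos (ψ ∧ᵣ ξ) (inj₁ p) = cl p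
  ctxPos (ψ ∧ᵣ ξ) (inj₂ c) = cr (ctxPos ξ c)

  holePos : ∀ {α} (ξ : Ctx) → Pos α → Pos (plug ξ α)
  holePos □ p = p
  holePos (ξ ∨ₗ ψ) p = inl (holePos ξ p)
  holePos (ψ ∨ᵣ ξ) p = inr (holePos ξ p)
  holePos (ξ ∧ₗ ψ) p = cl (holePos ξ p)
  holePos (ψ ∧ᵣ ξ) p = cr (holePos ξ p)

  data ARule : Formula → Formula → Set where
    ai↓ : (a : A) → ARule 𝕥 (atom a ∨ atom (bar a))
    aw↓ : (a : A) → ARule 𝕗 (atom a)
    ac↓ : (a : A) → ARule (atom a ∨ atom a) (atom a)
    ai↑ : (a : A) → ARule (atom a ∧ atom (bar a)) 𝕗
    aw↑ : (a : A) → ARule (atom a) 𝕥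
    ac↑ : (a : A) → ARule (atom a) (atom a ∧ atom a)

  alabel : ∀ {α β} → ARule α β → Label
  alabel (ai↓ a) = ai↓
  alabel (aw↓ a) = aw↓
  alabel (ac↓ a) = ac↓
  alabel (ai↑ a) = ai↑
  alabel (aw↑ a) = aw↑
  alabel (ac↑ a) = ac↑

  -- switch, medial and the equality rules (each direction listed)
  data SRule : Formula → Formula → Set where
    s      : ∀ {α β γ} → SRule (α ∧ (β ∨ γ)) ((α ∧ β) ∨ γ)
    m      : ∀ {α β γ δ} → SRule ((α ∧ β) ∨ (γ ∧ δ)) ((α ∨ γ) ∧ (β ∨ δ))
    comm∨  : ∀ {α β} → SRule (α ∨ β) (β ∨ α)
    comm∧  : ∀ {α β} → SRule (α ∧ β) (β ∧ α)
    assoc∨ : ∀ {α β γ} → SRule (α ∨ (β ∨ γ)) ((α ∨ β) ∨ γ)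
    assoc∨⁻ : ∀ {α β γ} → SRule ((α ∨ β) ∨ γ) (α ∨ (β ∨ γ))
    assoc∧ : ∀ {α β γ} → SRule (α ∧ (β ∧ γ)) ((α ∧ β) ∧ γ)
    assoc∧⁻ : ∀ {α β γ} → SRule ((α ∧ β) ∧ γ) (α ∧ (β ∧ γ))
    unit∨  : ∀ {α} → SRule (α ∨ 𝕗) α
    unit∨⁻ : ∀ {α} → SRule α (α ∨ 𝕗)
    unit∧  : ∀ {α} → SRule (α ∧ 𝕥) α
    unit∧⁻ : ∀ {α} → SRule α (α ∧ 𝕥)
    tt     : SRule (𝕥 ∨ 𝕥) 𝕥
    tt⁻    : SRule 𝕥 (𝕥 ∨ 𝕥)
    ff     : SRule (𝕗 ∧ 𝕗) 𝕗
    ff⁻    : SRule 𝕗 (𝕗 ∧ 𝕗)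

  -- correspondence of occurrences inside the metavariables α, β, γ, δ
  track : ∀ {α β} → SRule α β → Pos α → Pos β
  track s (cl p) = inl (cl p)
  track s (cr (inl p)) = inl (cr p)
  track s (cr (inr p)) = inr p
  track m (inl (cl p)) = cl (inl p)
  track m (inl (cr p)) = cr (inl p)
  track m (inr (cl p)) = cl (inr p)
  track m (inr (cr p)) = cr (inr p)
  track comm∨ (inl p) = inr p
  track comm∨ (inr p) = inl p
  track comm∧ (cl p) = cr p
  track comm∧ (cr p) = cl p
  track assoc∨ (inl p) = inl (inl p)
  track assoc∨ (inr (inl p)) = inl (inr p)
  track assoc∨ (inr (inr p)) = inr p
  track assoc∨⁻ (inl (inl p)) = inl p
  track assoc∨⁻ (inl (inr p)) = inr (inl p)
  track assoc∨⁻ (inr p) = inr (inr p)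
  track assoc∧ (cl p) = cl (cl p)
  track assoc∧ (cr (cl p)) = cl (cr p)
  track assoc∧ (cr (cr p)) = cr p
  track assoc∧⁻ (cl (cl p)) = cl p
  track assoc∧⁻ (cl (cr p)) = cr (cl p)
  track assoc∧⁻ (cr p) = cr (cr p)
  track unit∨ (inl p) = p
  track unit∨ (inr ())
  track unit∨⁻ p = inl p
  track unit∧ (cl p) = p
  track unit∧ (cr ())
  track unit∧⁻ p = cl p
  track tt (inl ())
  track tt (inr ())
  track tt⁻ ()
  track ff (cl ())
  track ff (cr ())
  track ff⁻ ()

  data Step : Formula → Formula → Set where
    astep : ∀ {α β} (ξ : Ctx) → ARule α β → Step (plug ξ α) (plug ξ β)
    sstep : ∀ {α β} (ξ : Ctx) → SRule α β → Step (plug ξ α) (plug ξ β)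

  IsAtomicStep : ∀ {φ ψ} → Step φ ψ → Set
  IsAtomicStep (astep ξ r) = ⊤
  IsAtomicStep (sstep ξ r) = ⊥

  -- context occurrences (and, for s/m/=, metavariable occurrences) keep their edge
  Carry : ∀ {φ ψ} {E : Set} → Step φ ψ → (Pos φ → E) → (Pos ψ → E) → Set
  Carry (astep ξ r) σ₀ σ₁ = ∀ c → σ₀ (ctxPos ξ c) ≡ σ₁ (ctxPos ξ c)
  Carry (sstep ξ r) σ₀ σ₁ =
    (∀ c → σ₀ (ctxPos ξ c) ≡ σ₁ (ctxPos ξ c)) ×
    (∀ p → σ₀ (holePos ξ p) ≡ σ₁ (holePos ξ (track r p)))

  VertexOK : (F : Flow) → Fin (Flow.nV F) → ∀ {φ ψ} (st : Step φ ψ) → IsAtomicStep st →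
             (Pos φ → Fin (Flow.nE F)) → (Pos ψ → Fin (Flow.nE F)) → Set
  VertexOK F ν (astep ξ r) _ σ₀ σ₁ =
    (Flow.label F ν ≡ alabel r) ×
    BijOnto (λ p → σ₀ (holePos ξ p)) (λ e → Flow.lower F e ≡ just ν) ×
    BijOnto (λ q → σ₁ (holePos ξ q)) (λ e → Flow.upper F e ≡ just ν)
  VertexOK F ν (sstep ξ r) ()

  record Derivation : Set where
    field
      len  : ℕ
      form : Fin (suc len) → Formula
      step : (i : Fin len) → Step (form (inject₁ i)) (form (suc i))

  Occ : Derivation → Set
  Occ D = Σ (Fin (suc len)) (λ i → Pos (form i))
    where open Derivation D

  IsFlowOf : Flow → Derivation → Set
  IsFlowOf F D =
    Σ (Occ D → Fin nE) λ σ →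
    Σ (Σ (Fin len) (λ i → IsAtomicStep (step i)) → Fin nV) λ vtx →
      (∀ e → ∃ λ o → σ o ≡ e) ×
      IsBij vtx ×
      (∀ i → Carry (step i) (λ p → σ (inject₁ i , p)) (λ q → σ (suc i , q))) ×
      (∀ i (a : IsAtomicStep (step i)) →
         VertexOK F (vtx (i , a)) (step i) a (λ p → σ (inject₁ i , p)) (λ q → σ (suc i , q))) ×
      BijOnto (λ p → σ (zero , p)) (λ e → upper e ≡ nothing) ×
      BijOnto (λ p → σ (fromℕ len , p)) (λ e → lower e ≡ nothing)
    where
      open Derivation D
      open Flow F

IsFlowOfSomeDerivation : (A : Set) (bar : A → A) → Flow → Set
IsFlowOfSomeDerivation A bar F = Σ (Syntax.Derivation A bar) (Syntax.IsFlowOf A bar F)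

module Submission where

-- The vertices of the flow F are processed one at a time, each
-- time choosing a source among the unprocessed vertices (one exists because F is
-- acyclic).  The edges crossing the cut between processed and unprocessed vertices
-- are represented by a frontier formula [(𝕗 ∧ a₁) ∨ [(𝕗 ∧ a₂) ∨ … 𝕗]], with one
-- slot per crossing edge, whose atom is a₀ or ā₀ according to the polarity of the
-- edge.  To process a source ν, the frontier is first permuted by = steps so that
-- the slots of the upper edges of ν come first; then a fixed gadget derivation,
-- containing a single instance of the atomic rule labelling ν, replaces them by
-- slots for the lower edges of ν.  The derivation runs from the frontier of the
-- ⊤-edges to the frontier of the ⊥-edges.
--
-- To see that F is its flow, derivations are built together with edge labellings
-- of all their atom occurrences ('LDeriv'), so that the conditions of 'IsFlowOf'
-- hold by construction.

open import Defs
open import Relation.Binary.PropositionalEquality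
  using (_≡_; _≢_; _≗_; refl; sym; trans; cong; cong₂; subst; setoid)
open import Data.Nat using (ℕ; zero; suc; _<_; _≤_; s≤s)
import Data.Nat.Properties as ℕ
open import Data.Fin using (Fin; zero; suc; toℕ; inject₁; fromℕ; _≟_)
import Data.Fin.Properties as FinP
open import Data.Fin.Subset using (Subset; ⁅_⁆; Nonempty; ∣_∣)
  renaming (_∈_ to _∈ₛ_; _∉_ to _∉ₛ_; _-_ to _∖_; ⊤ to full)
import Data.Fin.Subset.Properties as SubsetP
open import Data.Fin.Subset.Properties using () renaming (_∈?_ to _∈ₛ?_)
open import Data.Maybe using (Maybe; just; nothing)
import Data.Maybe.Properties as MaybeP
open import Data.Bool using (Bool; true; false)
open import Data.Empty using (⊥-elim)
open import Data.Unit using (⊤; tt)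
open import Data.Sum using (_⊎_; inj₁; inj₂; [_,_]′)
open import Data.Product using (Σ; ∃; _×_; _,_; proj₁; proj₂)
open import Data.Vec using (_∷_; there)
open import Data.List using (List; []; _∷_; _++_; length; map)
import Data.List.Properties
open import Data.List.Membership.Propositional using (_∈_; _∉_)
open import Data.List.Membership.Propositional.Properties
  using (∈-map⁺; ∈-map⁻; ∈-++⁺ˡ; ∈-++⁺ʳ; ∈-++⁻; ∈-∃++)
open import Data.List.Relation.Unary.Any using (here; there)
open import Data.List.Relation.Unary.All using (All; []; _∷_)
import Data.List.Relation.Unary.All as All
open import Data.List.Relation.Unary.AllPairs using (_∷_)
open import Data.List.Relation.Unary.Unique.Propositional using (Unique; [])
import Data.List.Relation.Unary.Unique.Propositional.Properties as UniqueP
open import Data.List.Relation.Binary.Permutation.Propositional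
  using (_↭_; ↭-refl; ↭-prep; ↭-trans; ↭-sym; ↭⇒↭ₛ)
import Data.List.Relation.Binary.Permutation.Propositional as ↭
import Data.List.Relation.Binary.Permutation.Propositional.Properties as PermP
import Data.List.Relation.Binary.Permutation.Setoid.Properties
open import Relation.Nullary using (yes; no; does; ¬_)
open import Relation.Nullary.Decidable using (dec-true; dec-false)
open import Relation.Unary using (Decidable)

countF-true : ∀ {n} (Q : Fin (suc n) → Bool) → Q zero ≡ true →
              countF Q ≡ suc (countF (λ i → Q (suc i)))
countF-true Q q with Q zero
... | true = refl

countF-false : ∀ {n} (Q : Fin (suc n) → Bool) → Q zero ≡ false →
               countF Q ≡ countF (λ i → Q (suc i))
countF-false Q q with Q zero
... | false = refl

record Enumerates {X : Set} (P : X → Set) (L : List X) : Set where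
  field
    unique   : Unique L
    sound    : ∀ {x} → x ∈ L → P x
    complete : ∀ {x} → P x → x ∈ L

record Enumeration {n : ℕ} {P : Fin n → Set} (P? : Decidable P) : Set where
  field
    list       : List (Fin n)
    enumerates : Enumerates P list
    counted    : length list ≡ countF (λ i → does (P? i))

enumerate : ∀ {n} {P : Fin n → Set} (P? : Decidable P) → Enumeration P?
enumerate {zero} P? = record
  { list = [] ; enumerates = record { unique = [] ; sound = λ () ; complete = λ {i} _ → ⊥-elim (FinP.¬Fin0 i) }
  ; counted = refl }
enumerate {suc n} {P} P? with enumerate (λ i → P? (suc i)) | P? zero
... | tail | yes P0 = record
  { list       = zero ∷ map suc list
  ; enumerates = record
    { unique   = All.tabulate zero∉ ∷ UniqueP.map⁺ FinP.suc-injective unique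
    ; sound    = λ { (here refl) → P0 ; (there i∈) → sound-suc i∈ }
    ; complete = λ { {zero} _ → here refl ; {suc i} Pi → there (∈-map⁺ suc (complete Pi)) } }
  ; counted    = trans (cong suc (trans (Data.List.Properties.length-map suc list) counted))
                       (sym (countF-true (λ i → does (P? i)) (dec-true (P? zero) P0))) }
  where
    open Enumeration tail
    open Enumerates enumerates
    zero∉ : ∀ {j} → j ∈ map suc list → zero ≢ j
    zero∉ j∈ refl with ∈-map⁻ suc j∈
    ... | _ , _ , ()
    sound-suc : ∀ {j} → j ∈ map suc list → P j
    sound-suc j∈ with ∈-map⁻ suc j∈
    ... | i , i∈ , refl = sound i∈
... | tail | no ¬P0 = record
  { list       = map suc list
  ; enumerates = record
    { unique   = UniqueP.map⁺ FinP.suc-injective unique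
    ; sound    = sound-suc
    ; complete = λ { {zero} P0 → ⊥-elim (¬P0 P0) ; {suc i} Pi → ∈-map⁺ suc (complete Pi) } }
  ; counted    = trans (trans (Data.List.Properties.length-map suc list) counted)
                       (sym (countF-false (λ i → does (P? i)) (dec-false (P? zero) ¬P0))) }
  where
    open Enumeration tail
    open Enumerates enumerates
    sound-suc : ∀ {j} → j ∈ map suc list → P j
    sound-suc j∈ with ∈-map⁻ suc j∈
    ... | i , i∈ , refl = sound i∈

Exactly₀ : {X : Set} → (X → Set) → Set
Exactly₀ P = ∀ x → ¬ P x

Exactly₁ : {X : Set} → (X → Set) → X → Set
Exactly₁ P u = P u × (∀ x → P x → x ≡ u)

Exactly₂ : {X : Set} → (X → Set) → X → X → Set
Exactly₂ P u₁ u₂ = (u₁ ≢ u₂) × P u₁ × P u₂ × (∀ x → P x → (x ≡ u₁) ⊎ (x ≡ u₂))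

first : ∀ {X} {P : X → Set} {x L} → Enumerates P (x ∷ L) → P x
first en = Enumerates.sound en (here refl)

second : ∀ {X} {P : X → Set} {x y L} → Enumerates P (x ∷ y ∷ L) → P y
second en = Enumerates.sound en (there (here refl))

exactly₀ : ∀ {X} {P : X → Set} → Enumerates P [] → Exactly₀ P
exactly₀ en x Px with Enumerates.complete en Px
... | ()

exactly₁ : ∀ {X} {P : X → Set} {u} → Enumerates P (u ∷ []) → Exactly₁ P u
exactly₁ en = first en , λ x Px → only (complete Px)
  where
    open Enumerates en
    only : ∀ {x u} → x ∈ u ∷ [] → x ≡ u
    only (here eq) = eq

exactly₂ : ∀ {X} {P : X → Set} {u₁ u₂} → Enumerates P (u₁ ∷ u₂ ∷ []) → Exactly₂ P u₁ u₂
exactly₂ en = distinct unique , first en , second en , λ x Px → either (complete Px)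
  where
    open Enumerates en
    distinct : ∀ {X : Set} {u₁ u₂ : X} → Unique (u₁ ∷ u₂ ∷ []) → u₁ ≢ u₂
    distinct ((u₁≢u₂ ∷ []) ∷ _) = u₁≢u₂
    either : ∀ {X : Set} {x u₁ u₂ : X} → x ∈ u₁ ∷ u₂ ∷ [] → (x ≡ u₁) ⊎ (x ≡ u₂)
    either (here eq) = inj₁ eq
    either (there (here eq)) = inj₂ eq

length-0 : ∀ {X : Set} (xs : List X) → length xs ≡ 0 → xs ≡ []
length-0 [] _ = refl

length-1 : ∀ {X : Set} (xs : List X) → length xs ≡ 1 → ∃ λ x → xs ≡ x ∷ []
length-1 (x ∷ []) _ = x , refl

length-2 : ∀ {X : Set} (xs : List X) → length xs ≡ 2 → ∃ λ x → ∃ λ y → xs ≡ x ∷ y ∷ []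
length-2 (x ∷ y ∷ []) _ = x , y , refl

∈-delete : ∀ {X : Set} (xs : List X) {u ys x} → x ∈ xs ++ u ∷ ys → x ≢ u → x ∈ xs ++ ys
∈-delete [] (here refl) x≢u = ⊥-elim (x≢u refl)
∈-delete [] (there x∈) x≢u = x∈
∈-delete (_ ∷ xs) (here eq) x≢u = here eq
∈-delete (_ ∷ xs) (there x∈) x≢u = there (∈-delete xs x∈ x≢u)

pullToFront : ∀ {X : Set} (U L : List X) → Unique U → (∀ {x} → x ∈ U → x ∈ L) →
              ∃ λ R → L ↭ U ++ R
pullToFront [] L _ _ = L , ↭-refl
pullToFront (u ∷ U) L (u∉U ∷ uniqU) U⊆L with ∈-∃++ (U⊆L (here refl))
... | xs , ys , refl with pullToFront U (xs ++ ys) uniqU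
                            (λ x∈ → ∈-delete xs (U⊆L (there x∈)) (λ { refl → All.lookup u∉U x∈ refl }))
...   | R , L↭UR = R , ↭-trans (PermP.shift u xs ys) (↭-prep u L↭UR)

unique-↭ : ∀ {X : Set} {xs ys : List X} → xs ↭ ys → Unique xs → Unique ys
unique-↭ {X} p = PermS.Unique-resp-↭ (↭⇒↭ₛ p)
  where module PermS = Data.List.Relation.Binary.Permutation.Setoid.Properties (setoid X)

unique-++⁻ : ∀ {X : Set} (U : List X) {R} → Unique (U ++ R) →
             Unique R × (∀ {x} → x ∈ U → x ∉ R)
unique-++⁻ [] uniq = uniq , λ ()
unique-++⁻ (u ∷ U) (u∉ ∷ uniq) =
  proj₁ (unique-++⁻ U uniq) ,
  λ { (here refl) x∈R → All.lookup u∉ (∈-++⁺ʳ U x∈R) refl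
    ; (there x∈U) → proj₂ (unique-++⁻ U uniq) x∈U }

search : ∀ {n} {P Q : Fin n → Set} → (∀ i → P i ⊎ Q i) → (∃ P) ⊎ (∀ i → Q i)
search {zero} P⊎Q = inj₂ (λ ())
search {suc n} P⊎Q with P⊎Q zero | search (λ i → P⊎Q (suc i))
... | inj₁ P0 | _ = inj₁ (zero , P0)
... | inj₂ _  | inj₁ (i , Pi) = inj₁ (suc i , Pi)
... | inj₂ Q0 | inj₂ Qs = inj₂ λ { zero → Q0 ; (suc i) → Qs i }

x∉p∖x : ∀ {n} {p : Subset n} (x : Fin n) → x ∉ₛ p ∖ x
x∉p∖x {p = _ ∷ _} zero ()
x∉p∖x {p = _ ∷ _} (suc x) (there x∈) = x∉p∖x x x∈

∈-∖⁻ : ∀ {n} {p : Subset n} {x y} → x ∈ₛ p ∖ y → x ∈ₛ p × x ≢ y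
∈-∖⁻ {p = p} {y = y} x∈ = SubsetP.p─q⊆p p ⁅ y ⁆ x∈ , λ { refl → x∉p∖x y x∈ }

bijOnto-≗ : ∀ {X Y : Set} {f g : X → Y} {P : Y → Set} → f ≗ g → BijOnto g P → BijOnto f P
bijOnto-≗ {P = P} f≗g (inP , inj , surj) =
  (λ x → subst P (sym (f≗g x)) (inP x)) ,
  (λ x y eq → inj x y (trans (sym (f≗g x)) (trans eq (f≗g y)))) ,
  (λ y Py → let x , gx≡y = surj y Py in x , trans (f≗g x) gx≡y)

module LabelledDerivations (A : Set) (bar : A → A) (F : Flow) where
  open Syntax A bar
  open Flow F

  Edge : Set
  Edge = Fin nE

  Vertex : Set
  Vertex = Fin nV

  UpperEdge LowerEdge : Vertex → Edge → Set
  UpperEdge ν e = lower e ≡ just ν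
  LowerEdge ν e = upper e ≡ just ν

  Labelling : Formula → Set
  Labelling φ = Pos φ → Edge

  data LDeriv : (φ : Formula) → Labelling φ → (ψ : Formula) → Labelling ψ → Set where
    done   : ∀ {φ σ τ} → σ ≗ τ → LDeriv φ σ φ τ
    struct : ∀ {α β} (ξ : Ctx) (r : SRule α β) {σ₀ σ₁ ψ τ} →
             Carry (sstep ξ r) σ₀ σ₁ → LDeriv (plug ξ β) σ₁ ψ τ → LDeriv (plug ξ α) σ₀ ψ τ
    vertex : ∀ {α β} (ξ : Ctx) (r : ARule α β) (ν : Vertex) {σ₀ σ₁ ψ τ} →
             Carry (astep ξ r) σ₀ σ₁ → VertexOK F ν (astep ξ r) tt σ₀ σ₁ →
             LDeriv (plug ξ β) σ₁ ψ τ → LDeriv (plug ξ α) σ₀ ψ τ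

  vertices : ∀ {φ σ ψ τ} → LDeriv φ σ ψ τ → List Vertex
  vertices (done _) = []
  vertices (struct _ _ _ d) = vertices d
  vertices (vertex _ _ ν _ _ d) = ν ∷ vertices d

  Occurs : ∀ {φ σ ψ τ} → LDeriv φ σ ψ τ → Edge → Set
  Occurs {σ = σ} (done _) e = ∃ λ p → σ p ≡ e
  Occurs {σ = σ} (struct _ _ _ d) e = (∃ λ p → σ p ≡ e) ⊎ Occurs d e
  Occurs {σ = σ} (vertex _ _ _ _ _ d) e = (∃ λ p → σ p ≡ e) ⊎ Occurs d e

  occurs-start : ∀ {φ σ ψ τ} (d : LDeriv φ σ ψ τ) p → Occurs d (σ p)
  occurs-start (done _) p = p , refl
  occurs-start (struct _ _ _ _) p = inj₁ (p , refl)
  occurs-start (vertex _ _ _ _ _ _) p = inj₁ (p , refl)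

  relabel : ∀ {φ σ σ' ψ τ} → σ' ≗ σ → LDeriv φ σ ψ τ → LDeriv φ σ' ψ τ
  relabel eq (done σ≗τ) = done (λ p → trans (eq p) (σ≗τ p))
  relabel eq (struct ξ r (ctx , hole) d) =
    struct ξ r ((λ c → trans (eq _) (ctx c)) , (λ p → trans (eq _) (hole p))) d
  relabel eq (vertex ξ r ν ctx (lab , ups , lows) d) =
    vertex ξ r ν (λ c → trans (eq _) (ctx c)) (lab , bijOnto-≗ (λ _ → eq _) ups , lows) d

  vertices-relabel : ∀ {φ σ σ' ψ τ} (eq : σ' ≗ σ) (d : LDeriv φ σ ψ τ) →
                     vertices (relabel eq d) ≡ vertices d
  vertices-relabel eq (done _) = refl
  vertices-relabel eq (struct _ _ _ _) = refl
  vertices-relabel eq (vertex _ _ _ _ _ _) = refl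

  occurs-relabel : ∀ {φ σ σ' ψ τ} (eq : σ' ≗ σ) (d : LDeriv φ σ ψ τ) {e} →
                   Occurs d e → Occurs (relabel eq d) e
  occurs-relabel eq (done _) (p , σp≡e) = p , trans (eq p) σp≡e
  occurs-relabel eq (struct _ _ _ _) (inj₁ (p , σp≡e)) = inj₁ (p , trans (eq p) σp≡e)
  occurs-relabel eq (struct _ _ _ _) (inj₂ o) = inj₂ o
  occurs-relabel eq (vertex _ _ _ _ _ _) (inj₁ (p , σp≡e)) = inj₁ (p , trans (eq p) σp≡e)
  occurs-relabel eq (vertex _ _ _ _ _ _) (inj₂ o) = inj₂ o

  infixr 5 _⨟_
  _⨟_ : ∀ {φ σ ψ τ χ ρ} → LDeriv φ σ ψ τ → LDeriv ψ τ χ ρ → LDeriv φ σ χ ρ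
  done eq ⨟ d₂ = relabel eq d₂
  struct ξ r c d₁ ⨟ d₂ = struct ξ r c (d₁ ⨟ d₂)
  vertex ξ r ν c ok d₁ ⨟ d₂ = vertex ξ r ν c ok (d₁ ⨟ d₂)

  vertices-⨟ : ∀ {φ σ ψ τ χ ρ} (d₁ : LDeriv φ σ ψ τ) (d₂ : LDeriv ψ τ χ ρ) →
               vertices (d₁ ⨟ d₂) ≡ vertices d₁ ++ vertices d₂
  vertices-⨟ (done eq) d₂ = vertices-relabel eq d₂
  vertices-⨟ (struct _ _ _ d₁) d₂ = vertices-⨟ d₁ d₂
  vertices-⨟ (vertex _ _ ν _ _ d₁) d₂ = cong (ν ∷_) (vertices-⨟ d₁ d₂)

  occurs-⨟ : ∀ {φ σ ψ τ χ ρ} (d₁ : LDeriv φ σ ψ τ) (d₂ : LDeriv ψ τ χ ρ) {e} →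
             Occurs d₂ e → Occurs (d₁ ⨟ d₂) e
  occurs-⨟ (done eq) d₂ o = occurs-relabel eq d₂ o
  occurs-⨟ (struct _ _ _ d₁) d₂ o = inj₂ (occurs-⨟ d₁ d₂ o)
  occurs-⨟ (vertex _ _ _ _ _ d₁) d₂ o = inj₂ (occurs-⨟ d₁ d₂ o)

  #steps : ∀ {φ σ ψ τ} → LDeriv φ σ ψ τ → ℕ
  #steps (done _) = 0
  #steps (struct _ _ _ d) = suc (#steps d)
  #steps (vertex _ _ _ _ _ d) = suc (#steps d)

  formulaAt : ∀ {φ σ ψ τ} (d : LDeriv φ σ ψ τ) → Fin (suc (#steps d)) → Formula
  formulaAt {φ = φ} d zero = φ
  formulaAt (struct _ _ _ d) (suc i) = formulaAt d i
  formulaAt (vertex _ _ _ _ _ d) (suc i) = formulaAt d i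

  stepAt : ∀ {φ σ ψ τ} (d : LDeriv φ σ ψ τ) (i : Fin (#steps d)) →
           Step (formulaAt d (inject₁ i)) (formulaAt d (suc i))
  stepAt (struct ξ r _ _) zero = sstep ξ r
  stepAt (struct _ _ _ d) (suc i) = stepAt d i
  stepAt (vertex ξ r _ _ _ _) zero = astep ξ r
  stepAt (vertex _ _ _ _ _ d) (suc i) = stepAt d i

  labellingAt : ∀ {φ σ ψ τ} (d : LDeriv φ σ ψ τ) (i : Fin (suc (#steps d))) →
                Labelling (formulaAt d i)
  labellingAt {σ = σ} d zero = σ
  labellingAt (struct _ _ _ d) (suc i) = labellingAt d i
  labellingAt (vertex _ _ _ _ _ d) (suc i) = labellingAt d i

  toDerivation : ∀ {φ σ ψ τ} → LDeriv φ σ ψ τ → Derivation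
  toDerivation d = record { len = #steps d ; form = formulaAt d ; step = stepAt d }

  AtomicStep : ∀ {φ σ ψ τ} → LDeriv φ σ ψ τ → Set
  AtomicStep d = Σ (Fin (#steps d)) (λ i → IsAtomicStep (stepAt d i))

  vertexAt : ∀ {φ σ ψ τ} (d : LDeriv φ σ ψ τ) → AtomicStep d → Vertex
  vertexAt (struct _ _ _ d) (zero , ())
  vertexAt (struct _ _ _ d) (suc i , a) = vertexAt d (i , a)
  vertexAt (vertex _ _ ν _ _ d) (zero , _) = ν
  vertexAt (vertex _ _ _ _ _ d) (suc i , a) = vertexAt d (i , a)

  carryAt : ∀ {φ σ ψ τ} (d : LDeriv φ σ ψ τ) i →
            Carry (stepAt d i) (labellingAt d (inject₁ i)) (labellingAt d (suc i))
  carryAt (struct _ _ c _) zero = c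
  carryAt (struct _ _ _ d) (suc i) = carryAt d i
  carryAt (vertex _ _ _ c _ _) zero = c
  carryAt (vertex _ _ _ _ _ d) (suc i) = carryAt d i

  vertexOKAt : ∀ {φ σ ψ τ} (d : LDeriv φ σ ψ τ) i a →
               VertexOK F (vertexAt d (i , a)) (stepAt d i) a
                 (labellingAt d (inject₁ i)) (labellingAt d (suc i))
  vertexOKAt (struct _ _ _ d) zero ()
  vertexOKAt (struct _ _ _ d) (suc i) a = vertexOKAt d i a
  vertexOKAt (vertex _ _ _ _ ok _) zero a = ok
  vertexOKAt (vertex _ _ _ _ _ d) (suc i) a = vertexOKAt d i a

  occurrenceOf : ∀ {φ σ ψ τ} (d : LDeriv φ σ ψ τ) {e} → Occurs d e →
                 ∃ λ (o : Occ (toDerivation d)) → labellingAt d (proj₁ o) (proj₂ o) ≡ e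
  occurrenceOf (done _) (p , eq) = (zero , p) , eq
  occurrenceOf (struct _ _ _ d) (inj₁ (p , eq)) = (zero , p) , eq
  occurrenceOf (struct _ _ _ d) (inj₂ o) with occurrenceOf d o
  ... | (i , p) , eq = (suc i , p) , eq
  occurrenceOf (vertex _ _ _ _ _ d) (inj₁ (p , eq)) = (zero , p) , eq
  occurrenceOf (vertex _ _ _ _ _ d) (inj₂ o) with occurrenceOf d o
  ... | (i , p) , eq = (suc i , p) , eq

  vertexAt-∈ : ∀ {φ σ ψ τ} (d : LDeriv φ σ ψ τ) x → vertexAt d x ∈ vertices d
  vertexAt-∈ (struct _ _ _ d) (zero , ())
  vertexAt-∈ (struct _ _ _ d) (suc i , a) = vertexAt-∈ d (i , a)
  vertexAt-∈ (vertex _ _ _ _ _ d) (zero , _) = here refl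
  vertexAt-∈ (vertex _ _ _ _ _ d) (suc i , a) = there (vertexAt-∈ d (i , a))

  vertexAt-surjective : ∀ {φ σ ψ τ} (d : LDeriv φ σ ψ τ) {μ} → μ ∈ vertices d →
                        ∃ λ x → vertexAt d x ≡ μ
  vertexAt-surjective (struct _ _ _ d) μ∈ with vertexAt-surjective d μ∈
  ... | (i , a) , eq = (suc i , a) , eq
  vertexAt-surjective (vertex _ _ _ _ _ d) (here refl) = (zero , tt) , refl
  vertexAt-surjective (vertex _ _ _ _ _ d) (there μ∈) with vertexAt-surjective d μ∈
  ... | (i , a) , eq = (suc i , a) , eq

  vertexAt-injective : ∀ {φ σ ψ τ} (d : LDeriv φ σ ψ τ) → Unique (vertices d) →
                       ∀ x y → vertexAt d x ≡ vertexAt d y → x ≡ y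
  vertexAt-injective (struct _ _ _ d) u (zero , ()) y eq
  vertexAt-injective (struct _ _ _ d) u (suc i , a) (zero , ()) eq
  vertexAt-injective (struct _ _ _ d) u (suc i , a) (suc j , b) eq =
    cong (λ { (k , c) → suc k , c }) (vertexAt-injective d u (i , a) (j , b) eq)
  vertexAt-injective (vertex _ _ _ _ _ d) u (zero , a) (zero , b) eq = refl
  vertexAt-injective (vertex _ _ _ _ _ d) (ν∉ ∷ u) (zero , a) (suc j , b) eq =
    ⊥-elim (All.lookup ν∉ (vertexAt-∈ d (j , b)) eq)
  vertexAt-injective (vertex _ _ _ _ _ d) (ν∉ ∷ u) (suc i , a) (zero , b) eq =
    ⊥-elim (All.lookup ν∉ (vertexAt-∈ d (i , a)) (sym eq))
  vertexAt-injective (vertex _ _ _ _ _ d) (_ ∷ u) (suc i , a) (suc j , b) eq =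
    cong (λ { (k , c) → suc k , c }) (vertexAt-injective d u (i , a) (j , b) eq)

  labellingAt-last : ∀ {φ σ ψ τ} (d : LDeriv φ σ ψ τ) {P : Edge → Set} →
                     BijOnto τ P → BijOnto (labellingAt d (fromℕ (#steps d))) P
  labellingAt-last (done eq) bij = bijOnto-≗ eq bij
  labellingAt-last (struct _ _ _ d) bij = labellingAt-last d bij
  labellingAt-last (vertex _ _ _ _ _ d) bij = labellingAt-last d bij

  isFlowOf : ∀ {φ σ ψ τ} (d : LDeriv φ σ ψ τ) → (∀ e → Occurs d e) →
             Unique (vertices d) → (∀ μ → μ ∈ vertices d) →
             BijOnto σ (λ e → upper e ≡ nothing) → BijOnto τ (λ e → lower e ≡ nothing) →
             IsFlowOf F (toDerivation d)
  isFlowOf d occurs uniq all top bottom =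
    (λ o → labellingAt d (proj₁ o) (proj₂ o)) ,
    vertexAt d ,
    (λ e → occurrenceOf d (occurs e)) ,
    (vertexAt-injective d uniq , (λ μ → vertexAt-surjective d (all μ))) ,
    carryAt d ,
    vertexOKAt d ,
    top ,
    labellingAt-last d bottom

  fill : ∀ {β} (ξ : Ctx) → (CPos ξ → Edge) → Labelling β → Labelling (plug ξ β)
  fill □ c h q = h q
  fill (ξ ∨ₗ ψ) c h (inl q) = fill ξ (λ x → c (inj₁ x)) h q
  fill (ξ ∨ₗ ψ) c h (inr q) = c (inj₂ q)
  fill (ψ ∨ᵣ ξ) c h (inl q) = c (inj₁ q)
  fill (ψ ∨ᵣ ξ) c h (inr q) = fill ξ (λ x → c (inj₂ x)) h q
  fill (ξ ∧ₗ ψ) c h (cl q) = fill ξ (λ x → c (inj₁ x)) h q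
  fill (ξ ∧ₗ ψ) c h (cr q) = c (inj₂ q)
  fill (ψ ∧ᵣ ξ) c h (cl q) = c (inj₁ q)
  fill (ψ ∧ᵣ ξ) c h (cr q) = fill ξ (λ x → c (inj₂ x)) h q

  fill-ctx : ∀ {β} (ξ : Ctx) c (h : Labelling β) x → fill ξ c h (ctxPos ξ x) ≡ c x
  fill-ctx □ c h ()
  fill-ctx (ξ ∨ₗ ψ) c h (inj₁ x) = fill-ctx ξ _ h x
  fill-ctx (ξ ∨ₗ ψ) c h (inj₂ p) = refl
  fill-ctx (ψ ∨ᵣ ξ) c h (inj₁ p) = refl
  fill-ctx (ψ ∨ᵣ ξ) c h (inj₂ x) = fill-ctx ξ _ h x
  fill-ctx (ξ ∧ₗ ψ) c h (inj₁ x) = fill-ctx ξ _ h x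
  fill-ctx (ξ ∧ₗ ψ) c h (inj₂ p) = refl
  fill-ctx (ψ ∧ᵣ ξ) c h (inj₁ p) = refl
  fill-ctx (ψ ∧ᵣ ξ) c h (inj₂ x) = fill-ctx ξ _ h x

  fill-hole : ∀ {β} (ξ : Ctx) c (h : Labelling β) q → fill ξ c h (holePos ξ q) ≡ h q
  fill-hole □ c h q = refl
  fill-hole (ξ ∨ₗ ψ) c h q = fill-hole ξ _ h q
  fill-hole (ψ ∨ᵣ ξ) c h q = fill-hole ξ _ h q
  fill-hole (ξ ∧ₗ ψ) c h q = fill-hole ξ _ h q
  fill-hole (ψ ∧ᵣ ξ) c h q = fill-hole ξ _ h q

  untrack : ∀ {α β} → SRule α β → Pos β → Pos α
  untrack s (inl (cl p)) = cl p
  untrack s (inl (cr p)) = cr (inl p)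
  untrack s (inr p) = cr (inr p)
  untrack m (cl (inl p)) = inl (cl p)
  untrack m (cr (inl p)) = inl (cr p)
  untrack m (cl (inr p)) = inr (cl p)
  untrack m (cr (inr p)) = inr (cr p)
  untrack comm∨ (inl p) = inr p
  untrack comm∨ (inr p) = inl p
  untrack comm∧ (cl p) = cr p
  untrack comm∧ (cr p) = cl p
  untrack assoc∨ (inl (inl p)) = inl p
  untrack assoc∨ (inl (inr p)) = inr (inl p)
  untrack assoc∨ (inr p) = inr (inr p)
  untrack assoc∨⁻ (inl p) = inl (inl p)
  untrack assoc∨⁻ (inr (inl p)) = inl (inr p)
  untrack assoc∨⁻ (inr (inr p)) = inr p
  untrack assoc∧ (cl (cl p)) = cl p
  untrack assoc∧ (cl (cr p)) = cr (cl p)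
  untrack assoc∧ (cr p) = cr (cr p)
  untrack assoc∧⁻ (cl p) = cl (cl p)
  untrack assoc∧⁻ (cr (cl p)) = cl (cr p)
  untrack assoc∧⁻ (cr (cr p)) = cr p
  untrack unit∨ p = inl p
  untrack unit∨⁻ (inl p) = p
  untrack unit∨⁻ (inr ())
  untrack unit∧ p = cl p
  untrack unit∧⁻ (cl p) = p
  untrack unit∧⁻ (cr ())
  untrack tt ()
  untrack tt⁻ (inl ())
  untrack tt⁻ (inr ())
  untrack ff ()
  untrack ff⁻ (cl ())
  untrack ff⁻ (cr ())

  untrack-track : ∀ {α β} (r : SRule α β) p → untrack r (track r p) ≡ p
  untrack-track s (cl p) = refl
  untrack-track s (cr (inl p)) = refl
  untrack-track s (cr (inr p)) = refl
  untrack-track m (inl (cl p)) = refl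
  untrack-track m (inl (cr p)) = refl
  untrack-track m (inr (cl p)) = refl
  untrack-track m (inr (cr p)) = refl
  untrack-track comm∨ (inl p) = refl
  untrack-track comm∨ (inr p) = refl
  untrack-track comm∧ (cl p) = refl
  untrack-track comm∧ (cr p) = refl
  untrack-track assoc∨ (inl p) = refl
  untrack-track assoc∨ (inr (inl p)) = refl
  untrack-track assoc∨ (inr (inr p)) = refl
  untrack-track assoc∨⁻ (inl (inl p)) = refl
  untrack-track assoc∨⁻ (inl (inr p)) = refl
  untrack-track assoc∨⁻ (inr p) = refl
  untrack-track assoc∧ (cl p) = refl
  untrack-track assoc∧ (cr (cl p)) = refl
  untrack-track assoc∧ (cr (cr p)) = refl
  untrack-track assoc∧⁻ (cl (cl p)) = refl
  untrack-track assoc∧⁻ (cl (cr p)) = refl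
  untrack-track assoc∧⁻ (cr p) = refl
  untrack-track unit∨ (inl p) = refl
  untrack-track unit∨ (inr ())
  untrack-track unit∨⁻ p = refl
  untrack-track unit∧ (cl p) = refl
  untrack-track unit∧ (cr ())
  untrack-track unit∧⁻ p = refl
  untrack-track tt (inl ())
  untrack-track tt (inr ())
  untrack-track tt⁻ ()
  untrack-track ff (cl ())
  untrack-track ff (cr ())
  untrack-track ff⁻ ()

  -- Steps written with their premiss spelled out:  φ ⟶⟨ ξ ∣ r ⟩ d  is the step
  -- from φ = ξ{α} by rule r followed by d; Agda checks that φ is indeed ξ{α}.
  infix 4 _∣_
  data Rewrite (Rule : Formula → Formula → Set) : Formula → Formula → Set where
    _∣_ : ∀ {α β} (ξ : Ctx) → Rule α β → Rewrite Rule (plug ξ α) (plug ξ β)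

  moveLabels : ∀ {φ χ} → Rewrite SRule φ χ → Labelling φ → Labelling χ
  moveLabels (ξ ∣ r) σ = fill ξ (λ c → σ (ctxPos ξ c)) (λ q → σ (holePos ξ (untrack r q)))

  infixr 2 _⟶⟨_⟩_ _⟶⟨_⟩[_]_
  infix  3 _∎⟨_⟩

  _⟶⟨_⟩_ : ∀ {χ ψ τ} (φ : Formula) {σ : Labelling φ} (st : Rewrite SRule φ χ) →
           LDeriv χ (moveLabels st σ) ψ τ → LDeriv φ σ ψ τ
  _⟶⟨_⟩_ _ {σ} (ξ ∣ r) d = struct ξ r
    ((λ c → sym (fill-ctx ξ _ _ c)) ,
     (λ p → sym (trans (fill-hole ξ _ _ (track r p))
                       (cong (λ q → σ (holePos ξ q)) (untrack-track r p)))))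
    d

  record Firing {α β} (ξ : Ctx) (r : ARule α β) (σ : Labelling (plug ξ α)) : Set where
    constructor fire
    field
      ν          : Vertex
      outputs    : Labelling β
      label≡     : label ν ≡ alabel r
      inputs-ok  : BijOnto (λ p → σ (holePos ξ p)) (UpperEdge ν)
      outputs-ok : BijOnto outputs (LowerEdge ν)

  FiringAt : ∀ {φ χ} → Rewrite ARule φ χ → Labelling φ → Set
  FiringAt (ξ ∣ r) σ = Firing ξ r σ

  afterFiring : ∀ {φ χ σ} (st : Rewrite ARule φ χ) → FiringAt st σ → Labelling χ
  afterFiring {σ = σ} (ξ ∣ r) f = fill ξ (λ c → σ (ctxPos ξ c)) (Firing.outputs f)

  _⟶⟨_⟩[_]_ : ∀ {χ ψ τ} (φ : Formula) {σ : Labelling φ} (st : Rewrite ARule φ χ) (f : FiringAt st σ) →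
              LDeriv χ (afterFiring st f) ψ τ → LDeriv φ σ ψ τ
  _ ⟶⟨ ξ ∣ r ⟩[ fire ν out lab ins outs ] d =
    vertex ξ r ν (λ c → sym (fill-ctx ξ _ out c)) (lab , ins , bijOnto-≗ (fill-hole ξ _ out) outs) d

  _∎⟨_⟩ : (φ : Formula) {σ τ : Labelling φ} → σ ≗ τ → LDeriv φ σ φ τ
  _ ∎⟨ eq ⟩ = done eq

  _∨▹_ : ∀ {ψ₀} (ρ : Labelling ψ₀) → ∀ {φ} → Labelling φ → Labelling (ψ₀ ∨ φ)
  (ρ ∨▹ σ) (inl p) = ρ p
  (ρ ∨▹ σ) (inr q) = σ q

  liftRight : ∀ {ψ₀} (ρ : Labelling ψ₀) {φ σ ψ τ} →
              LDeriv φ σ ψ τ → LDeriv (ψ₀ ∨ φ) (ρ ∨▹ σ) (ψ₀ ∨ ψ) (ρ ∨▹ τ)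
  liftRight ρ (done eq) = done λ { (inl p) → refl ; (inr q) → eq q }
  liftRight {ψ₀} ρ (struct ξ r (ctx , hole) d) =
    struct (ψ₀ ∨ᵣ ξ) r ((λ { (inj₁ p) → refl ; (inj₂ c) → ctx c }) , hole) (liftRight ρ d)
  liftRight {ψ₀} ρ (vertex ξ r ν ctx ok d) =
    vertex (ψ₀ ∨ᵣ ξ) r ν (λ { (inj₁ p) → refl ; (inj₂ c) → ctx c }) ok (liftRight ρ d)

  vertices-liftRight : ∀ {ψ₀} (ρ : Labelling ψ₀) {φ σ ψ τ} (d : LDeriv φ σ ψ τ) →
                       vertices (liftRight ρ d) ≡ vertices d
  vertices-liftRight ρ (done _) = refl
  vertices-liftRight ρ (struct _ _ _ d) = vertices-liftRight ρ d
  vertices-liftRight ρ (vertex _ _ ν _ _ d) = cong (ν ∷_) (vertices-liftRight ρ d)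

  noAtom-bij : ∀ {φ} {P : Edge → Set} (f : Labelling φ) → ¬ Pos φ → Exactly₀ P → BijOnto f P
  noAtom-bij f noPos none =
    (λ p → ⊥-elim (noPos p)) , (λ p → ⊥-elim (noPos p)) , (λ e Pe → ⊥-elim (none e Pe))

  atom-bij : ∀ {x} {P : Edge → Set} (f : Labelling (atom x)) → Exactly₁ P (f here) → BijOnto f P
  atom-bij f (Pu , only) = (λ { here → Pu }) , (λ { here here _ → refl }) , (λ e Pe → here , sym (only e Pe))

  ∨-bij : ∀ {x y} {P : Edge → Set} (f : Labelling (atom x ∨ atom y)) →
          Exactly₂ P (f (inl here)) (f (inr here)) → BijOnto f P
  ∨-bij f (u₁≢u₂ , P₁ , P₂ , only) =
    (λ { (inl here) → P₁ ; (inr here) → P₂ }) ,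
    (λ { (inl here) (inl here) _ → refl ; (inr here) (inr here) _ → refl
       ; (inl here) (inr here) eq → ⊥-elim (u₁≢u₂ eq) ; (inr here) (inl here) eq → ⊥-elim (u₁≢u₂ (sym eq)) }) ,
    (λ e Pe → [ (λ eq → inl here , sym eq) , (λ eq → inr here , sym eq) ]′ (only e Pe))

  ∧-bij : ∀ {x y} {P : Edge → Set} (f : Labelling (atom x ∧ atom y)) →
          Exactly₂ P (f (cl here)) (f (cr here)) → BijOnto f P
  ∧-bij f (u₁≢u₂ , P₁ , P₂ , only) =
    (λ { (cl here) → P₁ ; (cr here) → P₂ }) ,
    (λ { (cl here) (cl here) _ → refl ; (cr here) (cr here) _ → refl
       ; (cl here) (cr here) eq → ⊥-elim (u₁≢u₂ eq) ; (cr here) (cl here) eq → ⊥-elim (u₁≢u₂ (sym eq)) }) ,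
    (λ e Pe → [ (λ eq → cl here , sym eq) , (λ eq → cr here , sym eq) ]′ (only e Pe))

  -- A slot 𝕗 ∧ a holds one atom occurrence in front of a disjunction R.  The unit
  -- 𝕗 is what allows an occurrence to disappear (𝕗 ∧ 𝕥 = 𝕗 and [𝕗 ∨ R] = R) or
  -- to appear (𝕗 = 𝕗 ∧ 𝕗 and 𝕗 ⟶ a) without touching the rest of the formula.
  slotLabel : ∀ {x} → Edge → Labelling (𝕗 ∧ atom x)
  slotLabel e (cr here) = e

  infixr 5 _◂_
  _◂_ : ∀ {x R} → Edge → Labelling R → Labelling ((𝕗 ∧ atom x) ∨ R)
  e ◂ σ = slotLabel e ∨▹ σ

  slot-η : ∀ {x R} {ρ : Labelling ((𝕗 ∧ atom x) ∨ R)} → ρ ≗ ρ (inl (cr here)) ◂ (λ q → ρ (inr q))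
  slot-η (inl (cl ()))
  slot-η (inl (cr here)) = refl
  slot-η (inr q) = refl

  slot-η₂ : ∀ {x y R} {ρ : Labelling ((𝕗 ∧ atom x) ∨ (𝕗 ∧ atom y) ∨ R)} →
            ρ ≗ ρ (inl (cr here)) ◂ ρ (inr (inl (cr here))) ◂ (λ q → ρ (inr (inr q)))
  slot-η₂ (inl (cl ()))
  slot-η₂ (inl (cr here)) = refl
  slot-η₂ (inr (inl (cl ())))
  slot-η₂ (inr (inl (cr here))) = refl
  slot-η₂ (inr (inr q)) = refl

  FiringOnly : Vertex → (φ : Formula) → Labelling φ → (ψ : Formula) → Labelling ψ → Set
  FiringOnly ν φ σ ψ τ = Σ (LDeriv φ σ ψ τ) λ d → vertices d ≡ ν ∷ []

  gadget-ai↓ : ∀ ν x y → y ≡ bar x → (w₁ w₂ : Edge) (R : Formula) (σ : Labelling R) →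
               label ν ≡ ai↓ → Exactly₀ (UpperEdge ν) → Exactly₂ (LowerEdge ν) w₁ w₂ →
               FiringOnly ν R σ ((𝕗 ∧ atom x) ∨ (𝕗 ∧ atom y) ∨ R) (w₁ ◂ w₂ ◂ σ)
  gadget-ai↓ ν x _ refl w₁ w₂ R σ lab none outs =
    (R                                                     ⟶⟨ □ ∣ unit∨⁻ ⟩
     R ∨ 𝕗                                                 ⟶⟨ □ ∣ comm∨ ⟩
     𝕗 ∨ R                                                 ⟶⟨ □ ∨ₗ R ∣ ff⁻ ⟩
     (𝕗 ∧ 𝕗) ∨ R                                           ⟶⟨ (𝕗 ∧ᵣ □) ∨ₗ R ∣ unit∧⁻ ⟩
     (𝕗 ∧ 𝕗 ∧ 𝕥) ∨ R                                       ⟶⟨ (𝕗 ∧ᵣ (𝕗 ∧ᵣ □)) ∨ₗ R ∣ ai↓ x ⟩[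
       fire ν out lab (noAtom-bij _ (λ ()) none) (∨-bij out outs) ]
     (𝕗 ∧ 𝕗 ∧ (atom x ∨ atom (bar x))) ∨ R                 ⟶⟨ (𝕗 ∧ᵣ □) ∨ₗ R ∣ s ⟩
     (𝕗 ∧ ((𝕗 ∧ atom x) ∨ atom (bar x))) ∨ R               ⟶⟨ (𝕗 ∧ᵣ □) ∨ₗ R ∣ comm∨ ⟩
     (𝕗 ∧ (atom (bar x) ∨ (𝕗 ∧ atom x))) ∨ R               ⟶⟨ □ ∨ₗ R ∣ s ⟩
     ((𝕗 ∧ atom (bar x)) ∨ (𝕗 ∧ atom x)) ∨ R               ⟶⟨ □ ∨ₗ R ∣ comm∨ ⟩
     ((𝕗 ∧ atom x) ∨ (𝕗 ∧ atom (bar x))) ∨ R               ⟶⟨ □ ∣ assoc∨⁻ ⟩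
     (𝕗 ∧ atom x) ∨ (𝕗 ∧ atom (bar x)) ∨ R                 ∎⟨ slot-η₂ ⟩) , refl
    where
      out : Labelling (atom x ∨ atom (bar x))
      out (inl here) = w₁
      out (inr here) = w₂

  gadget-aw↓ : ∀ ν x (w : Edge) (R : Formula) (σ : Labelling R) →
               label ν ≡ aw↓ → Exactly₀ (UpperEdge ν) → Exactly₁ (LowerEdge ν) w →
               FiringOnly ν R σ ((𝕗 ∧ atom x) ∨ R) (w ◂ σ)
  gadget-aw↓ ν x w R σ lab none outs =
    (R                      ⟶⟨ □ ∣ unit∨⁻ ⟩
     R ∨ 𝕗                  ⟶⟨ □ ∣ comm∨ ⟩
     𝕗 ∨ R                  ⟶⟨ □ ∨ₗ R ∣ ff⁻ ⟩
     (𝕗 ∧ 𝕗) ∨ R            ⟶⟨ (𝕗 ∧ᵣ □) ∨ₗ R ∣ aw↓ x ⟩[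
       fire ν out lab (noAtom-bij _ (λ ()) none) (atom-bij out outs) ]
     (𝕗 ∧ atom x) ∨ R       ∎⟨ slot-η ⟩) , refl
    where
      out : Labelling (atom x)
      out here = w

  gadget-aw↑ : ∀ ν x (u : Edge) (R : Formula) (σ : Labelling R) →
               label ν ≡ aw↑ → Exactly₁ (UpperEdge ν) u → Exactly₀ (LowerEdge ν) →
               FiringOnly ν ((𝕗 ∧ atom x) ∨ R) (u ◂ σ) R σ
  gadget-aw↑ ν x u R σ lab ins none =
    ((𝕗 ∧ atom x) ∨ R       ⟶⟨ (𝕗 ∧ᵣ □) ∨ₗ R ∣ aw↑ x ⟩[
       fire ν (λ ()) lab (atom-bij _ ins) (noAtom-bij _ (λ ()) none) ]
     (𝕗 ∧ 𝕥) ∨ R            ⟶⟨ □ ∨ₗ R ∣ unit∧ ⟩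
     𝕗 ∨ R                  ⟶⟨ □ ∣ comm∨ ⟩
     R ∨ 𝕗                  ⟶⟨ □ ∣ unit∨ ⟩
     R                      ∎⟨ (λ _ → refl) ⟩) , refl

  gadget-ai↑ : ∀ ν x y → y ≡ bar x → (u₁ u₂ : Edge) (R : Formula) (σ : Labelling R) →
               label ν ≡ ai↑ → Exactly₂ (UpperEdge ν) u₁ u₂ → Exactly₀ (LowerEdge ν) →
               FiringOnly ν ((𝕗 ∧ atom x) ∨ (𝕗 ∧ atom y) ∨ R) (u₁ ◂ u₂ ◂ σ) R σ
  gadget-ai↑ ν x _ refl u₁ u₂ R σ lab ins none =
    ((𝕗 ∧ atom x) ∨ (𝕗 ∧ atom (bar x)) ∨ R     ⟶⟨ □ ∣ assoc∨ ⟩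
     ((𝕗 ∧ atom x) ∨ (𝕗 ∧ atom (bar x))) ∨ R   ⟶⟨ (□ ∨ₗ (𝕗 ∧ atom (bar x))) ∨ₗ R ∣ comm∧ ⟩
     ((atom x ∧ 𝕗) ∨ (𝕗 ∧ atom (bar x))) ∨ R   ⟶⟨ □ ∨ₗ R ∣ m ⟩
     ((atom x ∨ 𝕗) ∧ (𝕗 ∨ atom (bar x))) ∨ R   ⟶⟨ (□ ∧ₗ (𝕗 ∨ atom (bar x))) ∨ₗ R ∣ unit∨ ⟩
     (atom x ∧ (𝕗 ∨ atom (bar x))) ∨ R         ⟶⟨ (atom x ∧ᵣ □) ∨ₗ R ∣ comm∨ ⟩
     (atom x ∧ (atom (bar x) ∨ 𝕗)) ∨ R         ⟶⟨ (atom x ∧ᵣ □) ∨ₗ R ∣ unit∨ ⟩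
     (atom x ∧ atom (bar x)) ∨ R               ⟶⟨ □ ∨ₗ R ∣ ai↑ x ⟩[
       fire ν (λ ()) lab (∧-bij _ ins) (noAtom-bij _ (λ ()) none) ]
     𝕗 ∨ R                                     ⟶⟨ □ ∣ comm∨ ⟩
     R ∨ 𝕗                                     ⟶⟨ □ ∣ unit∨ ⟩
     R                                         ∎⟨ (λ _ → refl) ⟩) , refl

  gadget-ac↓ : ∀ ν x y z → y ≡ x → z ≡ x → (u₁ u₂ w : Edge) (R : Formula) (σ : Labelling R) →
               label ν ≡ ac↓ → Exactly₂ (UpperEdge ν) u₁ u₂ → Exactly₁ (LowerEdge ν) w →
               FiringOnly ν ((𝕗 ∧ atom x) ∨ (𝕗 ∧ atom y) ∨ R) (u₁ ◂ u₂ ◂ σ) ((𝕗 ∧ atom z) ∨ R) (w ◂ σ)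
  gadget-ac↓ ν x _ _ refl refl u₁ u₂ w R σ lab ins outs =
    ((𝕗 ∧ atom x) ∨ (𝕗 ∧ atom x) ∨ R         ⟶⟨ □ ∣ assoc∨ ⟩
     ((𝕗 ∧ atom x) ∨ (𝕗 ∧ atom x)) ∨ R       ⟶⟨ □ ∨ₗ R ∣ m ⟩
     ((𝕗 ∨ 𝕗) ∧ (atom x ∨ atom x)) ∨ R       ⟶⟨ (□ ∧ₗ (atom x ∨ atom x)) ∨ₗ R ∣ unit∨ ⟩
     (𝕗 ∧ (atom x ∨ atom x)) ∨ R             ⟶⟨ (𝕗 ∧ᵣ □) ∨ₗ R ∣ ac↓ x ⟩[
       fire ν out lab (∨-bij _ ins) (atom-bij out outs) ]
     (𝕗 ∧ atom x) ∨ R                        ∎⟨ slot-η ⟩) , refl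
    where
      out : Labelling (atom x)
      out here = w

  gadget-ac↑ : ∀ ν x y z → y ≡ x → z ≡ x → (u w₁ w₂ : Edge) (R : Formula) (σ : Labelling R) →
               label ν ≡ ac↑ → Exactly₁ (UpperEdge ν) u → Exactly₂ (LowerEdge ν) w₁ w₂ →
               FiringOnly ν ((𝕗 ∧ atom x) ∨ R) (u ◂ σ) ((𝕗 ∧ atom y) ∨ (𝕗 ∧ atom z) ∨ R) (w₁ ◂ w₂ ◂ σ)
  gadget-ac↑ ν x _ _ refl refl u w₁ w₂ R σ lab ins outs =
    ((𝕗 ∧ atom x) ∨ R                        ⟶⟨ (𝕗 ∧ᵣ □) ∨ₗ R ∣ ac↑ x ⟩[
       fire ν out lab (atom-bij _ ins) (∧-bij out outs) ]
     (𝕗 ∧ atom x ∧ atom x) ∨ R               ⟶⟨ (□ ∧ₗ (atom x ∧ atom x)) ∨ₗ R ∣ unit∨⁻ ⟩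
     ((𝕗 ∨ 𝕗) ∧ atom x ∧ atom x) ∨ R         ⟶⟨ □ ∨ₗ R ∣ comm∧ ⟩
     ((atom x ∧ atom x) ∧ (𝕗 ∨ 𝕗)) ∨ R       ⟶⟨ □ ∨ₗ R ∣ assoc∧⁻ ⟩
     (atom x ∧ atom x ∧ (𝕗 ∨ 𝕗)) ∨ R         ⟶⟨ (atom x ∧ᵣ □) ∨ₗ R ∣ s ⟩
     (atom x ∧ ((atom x ∧ 𝕗) ∨ 𝕗)) ∨ R       ⟶⟨ (atom x ∧ᵣ □) ∨ₗ R ∣ comm∨ ⟩
     (atom x ∧ (𝕗 ∨ (atom x ∧ 𝕗))) ∨ R       ⟶⟨ □ ∨ₗ R ∣ s ⟩
     ((atom x ∧ 𝕗) ∨ (atom x ∧ 𝕗)) ∨ R       ⟶⟨ (□ ∨ₗ (atom x ∧ 𝕗)) ∨ₗ R ∣ comm∧ ⟩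
     ((𝕗 ∧ atom x) ∨ (atom x ∧ 𝕗)) ∨ R       ⟶⟨ ((𝕗 ∧ atom x) ∨ᵣ □) ∨ₗ R ∣ comm∧ ⟩
     ((𝕗 ∧ atom x) ∨ (𝕗 ∧ atom x)) ∨ R       ⟶⟨ □ ∣ assoc∨⁻ ⟩
     (𝕗 ∧ atom x) ∨ (𝕗 ∧ atom x) ∨ R         ∎⟨ slot-η₂ ⟩) , refl
    where
      out : Labelling (atom x ∧ atom x)
      out (cl here) = w₁
      out (cr here) = w₂

  module Frontier (atomOf : Edge → A) where

    frontier : List Edge → Formula
    frontier [] = 𝕗
    frontier (e ∷ L) = (𝕗 ∧ atom (atomOf e)) ∨ frontier L

    labels : (L : List Edge) → Labelling (frontier L)
    labels [] ()
    labels (e ∷ L) = e ◂ labels L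

    labels-∈ : ∀ L p → labels L p ∈ L
    labels-∈ (e ∷ L) (inl (cr here)) = here refl
    labels-∈ (e ∷ L) (inr q) = there (labels-∈ L q)

    labels-surjective : ∀ L {e} → e ∈ L → ∃ λ p → labels L p ≡ e
    labels-surjective (x ∷ L) (here refl) = inl (cr here) , refl
    labels-surjective (x ∷ L) (there e∈) with labels-surjective L e∈
    ... | q , eq = inr q , eq

    labels-injective : ∀ L → Unique L → ∀ p q → labels L p ≡ labels L q → p ≡ q
    labels-injective (e ∷ L) _ (inl (cr here)) (inl (cr here)) _ = refl
    labels-injective (e ∷ L) (e∉ ∷ _) (inl (cr here)) (inr q) eq = ⊥-elim (All.lookup e∉ (labels-∈ L q) eq)
    labels-injective (e ∷ L) (e∉ ∷ _) (inr p) (inl (cr here)) eq = ⊥-elim (All.lookup e∉ (labels-∈ L p) (sym eq))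
    labels-injective (e ∷ L) (_ ∷ u) (inr p) (inr q) eq = cong inr (labels-injective L u p q eq)

    labels-bij : ∀ {L} {P : Edge → Set} → Enumerates P L → BijOnto (labels L) P
    labels-bij {L} en =
      (λ p → sound (labels-∈ L p)) , labels-injective L unique , (λ e Pe → labels-surjective L (complete Pe))
      where open Enumerates en

    Reordering : List Edge → List Edge → Set
    Reordering L L' = Σ (LDeriv (frontier L) (labels L) (frontier L') (labels L')) λ d → vertices d ≡ []

    reorder : ∀ {L L'} → L ↭ L' → Reordering L L'
    reorder ↭.refl = done (λ _ → refl) , refl
    reorder (↭.prep x p) with reorder p
    ... | d , none = liftRight (slotLabel x) d , trans (vertices-liftRight (slotLabel x) d) none
    reorder {L' = _ ∷ _ ∷ ys} (↭.swap x y p) with reorder p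
    ... | d , none =
      liftRight (slotLabel x) (liftRight (slotLabel y) d) ⨟ swapSlots ,
      trans (vertices-⨟ (liftRight (slotLabel x) (liftRight (slotLabel y) d)) swapSlots)
            (cong (_++ []) (trans (vertices-liftRight (slotLabel x) (liftRight (slotLabel y) d)) (trans (vertices-liftRight (slotLabel y) d) none)))
      where
        swapSlots : LDeriv (frontier (x ∷ y ∷ ys)) (labels (x ∷ y ∷ ys)) (frontier (y ∷ x ∷ ys)) (labels (y ∷ x ∷ ys))
        swapSlots =
          (𝕗 ∧ atom (atomOf x)) ∨ (𝕗 ∧ atom (atomOf y)) ∨ frontier ys    ⟶⟨ □ ∣ assoc∨ ⟩
          ((𝕗 ∧ atom (atomOf x)) ∨ (𝕗 ∧ atom (atomOf y))) ∨ frontier ys  ⟶⟨ □ ∨ₗ frontier ys ∣ comm∨ ⟩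
          ((𝕗 ∧ atom (atomOf y)) ∨ (𝕗 ∧ atom (atomOf x))) ∨ frontier ys  ⟶⟨ □ ∣ assoc∨⁻ ⟩
          (𝕗 ∧ atom (atomOf y)) ∨ (𝕗 ∧ atom (atomOf x)) ∨ frontier ys    ∎⟨ slot-η₂ ⟩
    reorder (↭.trans p q) with reorder p | reorder q
    ... | d₁ , none₁ | d₂ , none₂ =
      d₁ ⨟ d₂ , trans (vertices-⨟ d₁ d₂) (cong₂ _++_ none₁ none₂)

-- In an acyclic graph every nonempty set S of vertices has a source: a member
-- none of whose predecessors is a member.  Otherwise one could walk backwards
-- inside S for more than nV steps, and by the pigeonhole principle close a cycle.
module Sources (F : Flow) (acyclic : ∀ ν → ¬ Reach F ν ν) where
  open Flow F

  IsSource : Subset nV → Fin nV → Set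
  IsSource S ν = ν ∈ₛ S × (∀ e {κ} → lower e ≡ just ν → upper e ≡ just κ → κ ∉ₛ S)

  fromMember? : ∀ S μ e → (∃ λ κ → lower e ≡ just μ × upper e ≡ just κ × κ ∈ₛ S)
                          ⊎ (∀ {κ} → lower e ≡ just μ → upper e ≡ just κ → κ ∉ₛ S)
  fromMember? S μ e with lower e | upper e
  ... | nothing | _ = inj₂ (λ ())
  ... | just μ' | nothing = inj₂ (λ _ ())
  ... | just μ' | just κ with μ' ≟ μ | κ ∈ₛ? S
  ...   | no μ'≢μ | _ = inj₂ (λ eq _ _ → μ'≢μ (MaybeP.just-injective eq))
  ...   | yes refl | yes κ∈ = inj₁ (κ , refl , refl , κ∈)
  ...   | yes refl | no κ∉ = inj₂ (λ { refl refl → κ∉ })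

  Descent : ℕ → Fin nV → Set
  Descent k μ = Σ (ℕ → Fin nV) λ w → w 0 ≡ μ × (∀ i → i < k → Reach F (w (suc i)) (w i))

  descend : ∀ S k μ → μ ∈ₛ S → ∃ (IsSource S) ⊎ Descent k μ
  descend S zero μ μ∈ = inj₂ ((λ _ → μ) , refl , λ i ())
  descend S (suc k) μ μ∈ with search (fromMember? S μ)
  ... | inj₂ none = inj₁ (μ , μ∈ , none)
  ... | inj₁ (e , κ , into , from , κ∈) with descend S k κ κ∈
  ...   | inj₁ src = inj₁ src
  ...   | inj₂ (w , w0≡κ , steps) = inj₂ (w′ , refl , steps′)
    where
      w′ : ℕ → Fin nV
      w′ zero = μ
      w′ (suc i) = w i
      steps′ : ∀ i → i < suc k → Reach F (w′ (suc i)) (w′ i)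
      steps′ zero _ = subst (λ v → Reach F v μ) (sym w0≡κ) (edge e from into)
      steps′ (suc i) (s≤s i<k) = steps i i<k

  descent-path : ∀ {k} (w : ℕ → Fin nV) → (∀ i → i < k → Reach F (w (suc i)) (w i)) →
                 ∀ {i j} → i < j → j ≤ k → Reach F (w j) (w i)
  descent-path w steps {i} {suc j} i<1+j 1+j≤k with ℕ.m<1+n⇒m<n∨m≡n i<1+j
  ... | inj₂ refl = steps i 1+j≤k
  ... | inj₁ i<j = steps j 1+j≤k ⨾ descent-path w steps i<j (ℕ.<⇒≤ 1+j≤k)

  -- A descent of length nV visits some vertex twice, which would close a cycle.
  source : ∀ S μ → μ ∈ₛ S → ∃ (IsSource S)
  source S μ μ∈ with descend S nV μ μ∈
  ... | inj₁ src = src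
  ... | inj₂ (w , _ , steps) with FinP.pigeonhole (ℕ.n<1+n nV) (λ i → w (toℕ i))
  ...   | i , j , i<j , wi≡wj =
    ⊥-elim (acyclic (w (toℕ i))
      (subst (λ v → Reach F v (w (toℕ i))) (sym wi≡wj)
        (descent-path w steps i<j (ℕ.≤-pred (FinP.toℕ<n j)))))

module Construction
    (A : Set) (bar : A → A) (bar-involutive : ∀ a → bar (bar a) ≡ a) (a₀ : A) (F : Flow)
    (arity : ∀ ν → (#upperEdges F ν ≡ upArity (Flow.label F ν)) ×
                   (#lowerEdges F ν ≡ lowArity (Flow.label F ν)))
    (acyclic : ∀ ν → ¬ Reach F ν ν)
    (π : Fin (Flow.nE F) → Polarity) (polarised : PolarityAssignment F π) where

  open Syntax A bar
  open Flow F
  open LabelledDerivations A bar F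
  open Sources F acyclic

  atomFor : Polarity → A
  atomFor + = a₀
  atomFor - = bar a₀

  atomOf : Edge → A
  atomOf e = atomFor (π e)

  open Frontier atomOf

  opposite-atoms : ∀ {p q} → p ≢ q → atomFor q ≡ bar (atomFor p)
  opposite-atoms {+} {+} p≢q = ⊥-elim (p≢q refl)
  opposite-atoms {+} { - } _ = refl
  opposite-atoms { - } {+} _ = sym (bar-involutive a₀)
  opposite-atoms { - } { - } p≢q = ⊥-elim (p≢q refl)

  interaction-atoms : ∀ ν {e e'} → IsAI F (label ν) → Incident F e ν → Incident F e' ν → e ≢ e' →
                      atomOf e' ≡ bar (atomOf e)
  interaction-atoms ν ai inc inc' e≢e' = opposite-atoms (proj₂ (polarised ν _ _ inc inc') ai e≢e')

  contraction-atoms : ∀ ν {e e'} → IsAC F (label ν) → Incident F e ν → Incident F e' ν →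
                      atomOf e' ≡ atomOf e
  contraction-atoms ν ac inc inc' = cong atomFor (sym (proj₁ (polarised ν _ _ inc inc') ac))

  -- The gadget of ν placed in front of the frontier R, given its upper edges U and
  -- lower edges W: the arities fix the shapes of U and W, the polarities the atoms.
  vertexGadget : ∀ ν {U W} → Enumerates (UpperEdge ν) U → Enumerates (LowerEdge ν) W →
                 length U ≡ upArity (label ν) → length W ≡ lowArity (label ν) → ∀ R →
                 FiringOnly ν (frontier (U ++ R)) (labels (U ++ R)) (frontier (W ++ R)) (labels (W ++ R))
  vertexGadget ν {U} {W} ups lows |U| |W| R with label ν in lab
  ... | ai↓ with length-0 U |U| | length-2 W |W|
  ...   | refl | w₁ , w₂ , refl =
    gadget-ai↓ ν _ _ (interaction-atoms ν (inj₁ lab) (inj₁ (first lows)) (inj₁ (second lows))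
                                        (proj₁ (exactly₂ lows)))
      w₁ w₂ (frontier R) (labels R) lab (exactly₀ ups) (exactly₂ lows)
  vertexGadget ν {U} {W} ups lows |U| |W| R | ai↑ with length-2 U |U| | length-0 W |W|
  ...   | u₁ , u₂ , refl | refl =
    gadget-ai↑ ν _ _ (interaction-atoms ν (inj₂ lab) (inj₂ (first ups)) (inj₂ (second ups))
                                        (proj₁ (exactly₂ ups)))
      u₁ u₂ (frontier R) (labels R) lab (exactly₂ ups) (exactly₀ lows)
  vertexGadget ν {U} {W} ups lows |U| |W| R | aw↓ with length-0 U |U| | length-1 W |W|
  ...   | refl | w , refl =
    gadget-aw↓ ν _ w (frontier R) (labels R) lab (exactly₀ ups) (exactly₁ lows)
  vertexGadget ν {U} {W} ups lows |U| |W| R | aw↑ with length-1 U |U| | length-0 W |W|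
  ...   | u , refl | refl =
    gadget-aw↑ ν _ u (frontier R) (labels R) lab (exactly₁ ups) (exactly₀ lows)
  vertexGadget ν {U} {W} ups lows |U| |W| R | ac↓ with length-2 U |U| | length-1 W |W|
  ...   | u₁ , u₂ , refl | w , refl =
    gadget-ac↓ ν _ _ _ (contraction-atoms ν (inj₁ lab) (inj₂ (first ups)) (inj₂ (second ups)))
                       (contraction-atoms ν (inj₁ lab) (inj₂ (first ups)) (inj₁ (first lows)))
      u₁ u₂ w (frontier R) (labels R) lab (exactly₂ ups) (exactly₁ lows)
  vertexGadget ν {U} {W} ups lows |U| |W| R | ac↑ with length-1 U |U| | length-2 W |W|
  ...   | u , refl | w₁ , w₂ , refl =
    gadget-ac↑ ν _ _ _ (contraction-atoms ν (inj₂ lab) (inj₂ (first ups)) (inj₁ (first lows)))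
                       (contraction-atoms ν (inj₂ lab) (inj₂ (first ups)) (inj₁ (second lows)))
      u w₁ w₂ (frontier R) (labels R) lab (exactly₁ ups) (exactly₂ lows)

  -- The vertices are processed in an order compatible with the edges; S is the
  -- set of vertices still to be processed.  An edge crosses the cut when its upper
  -- end has been processed (or is ⊤) and its lower end has not (or is ⊥); the
  -- frontier formula always lists exactly the crossing edges.
  Processed : Subset nV → Maybe Vertex → Set
  Processed S nothing = ⊤
  Processed S (just μ) = μ ∉ₛ S

  Pending : Subset nV → Maybe Vertex → Set
  Pending S nothing = ⊤
  Pending S (just κ) = κ ∈ₛ S

  Crossing : Subset nV → Edge → Set
  Crossing S e = Processed S (upper e) × Pending S (lower e)

  Future : Subset nV → Edge → Set
  Future S e = ∃ λ μ → upper e ≡ just μ × μ ∈ₛ S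

  UpClosed : Subset nV → Set
  UpClosed S = ∀ e {μ κ} → upper e ≡ just μ → lower e ≡ just κ → μ ∈ₛ S → κ ∈ₛ S

  processed-∖ : ∀ {S ν} m → Processed S m → Processed (S ∖ ν) m
  processed-∖ nothing _ = tt
  processed-∖ (just μ) μ∉ μ∈ = μ∉ (proj₁ (∈-∖⁻ μ∈))

  processed-∖⁻ : ∀ {S ν} m → Processed (S ∖ ν) m → (m ≡ just ν) ⊎ Processed S m
  processed-∖⁻ nothing _ = inj₂ tt
  processed-∖⁻ {ν = ν} (just μ) μ∉ with μ ≟ ν
  ... | yes refl = inj₁ refl
  ... | no μ≢ν = inj₂ (λ μ∈ → μ∉ (SubsetP.x∈p∧x≢y⇒x∈p-y μ∈ μ≢ν))

  pending-∖ : ∀ {S ν} m → Pending S m → m ≢ just ν → Pending (S ∖ ν) m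
  pending-∖ nothing _ _ = tt
  pending-∖ (just κ) κ∈ κ≢ν = SubsetP.x∈p∧x≢y⇒x∈p-y κ∈ (λ eq → κ≢ν (cong just eq))

  pending-∖⁻ : ∀ {S ν} m → Pending (S ∖ ν) m → Pending S m × m ≢ just ν
  pending-∖⁻ nothing _ = tt , λ ()
  pending-∖⁻ (just κ) κ∈ = proj₁ (∈-∖⁻ κ∈) , λ eq → proj₂ (∈-∖⁻ κ∈) (MaybeP.just-injective eq)

  -- Once ν is processed, its lower edges cross the cut: their lower ends are
  -- unprocessed successors of ν, and differ from ν by acyclicity.
  lowerEdge-crossing : ∀ {S ν} → UpClosed S → ν ∈ₛ S → ∀ e → LowerEdge ν e → Crossing (S ∖ ν) e
  lowerEdge-crossing {S} {ν} closed ν∈ e from rewrite from =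
    x∉p∖x ν , pending-lower (lower e) refl
    where
      pending-lower : ∀ m → lower e ≡ m → Pending (S ∖ ν) m
      pending-lower nothing _ = tt
      pending-lower (just κ) into =
        SubsetP.x∈p∧x≢y⇒x∈p-y (closed e from into ν∈) (λ { refl → acyclic ν (edge e from into) })

  upClosed-∖ : ∀ {S ν} → UpClosed S → IsSource S ν → UpClosed (S ∖ ν)
  upClosed-∖ closed (_ , noPred) e from into μ∈ with ∈-∖⁻ μ∈
  ... | μ∈S , _ = SubsetP.x∈p∧x≢y⇒x∈p-y (closed e from into μ∈S) (λ { refl → noPred e into from μ∈S })


  upperEnum : ∀ ν → Enumeration {P = UpperEdge ν} (λ e → MaybeP.≡-dec _≟_ (lower e) (just ν))
  upperEnum ν = enumerate (λ e → MaybeP.≡-dec _≟_ (lower e) (just ν))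

  lowerEnum : ∀ ν → Enumeration {P = LowerEdge ν} (λ e → MaybeP.≡-dec _≟_ (upper e) (just ν))
  lowerEnum ν = enumerate (λ e → MaybeP.≡-dec _≟_ (upper e) (just ν))

  -- One step of the construction: the upper edges of a source ν all cross the
  -- cut, so they can be brought to the front of the frontier and replaced by the
  -- lower edges of ν using the gadget of ν.
  record Advance (S : Subset nV) (ν : Vertex) (L : List Edge) : Set where
    field
      next          : List Edge
      next-crossing : Enumerates (Crossing (S ∖ ν)) next
      step          : FiringOnly ν (frontier L) (labels L) (frontier next) (labels next)

  advance : ∀ {S ν L} → UpClosed S → IsSource S ν → Enumerates (Crossing S) L → Advance S ν L
  advance {S} {ν} {L} closed (ν∈ , noPred) crossing = record
    { next          = W ++ R
    ; next-crossing = record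
      { unique   = UniqueP.++⁺ (unique lows) uniqR (λ { (e∈W , e∈R) → W∩R e∈W e∈R })
      ; sound    = sound-next
      ; complete = complete-next }
    ; step          = proj₁ reordering ⨟ proj₁ gadget ,
                      trans (vertices-⨟ (proj₁ reordering) (proj₁ gadget))
                            (cong₂ _++_ (proj₂ reordering) (proj₂ gadget)) }
    where
      open Enumerates
      module Cut = Enumerates crossing
      U = Enumeration.list (upperEnum ν)
      W = Enumeration.list (lowerEnum ν)
      ups = Enumeration.enumerates (upperEnum ν)
      lows = Enumeration.enumerates (lowerEnum ν)

      upper-crossing : ∀ {e} → e ∈ U → Crossing S e
      upper-crossing {e} e∈U = processed (upper e) refl , subst (Pending S) (sym (sound ups e∈U)) ν∈
        where
          processed : ∀ m → upper e ≡ m → Processed S m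
          processed nothing _ = tt
          processed (just κ) from = noPred e (sound ups e∈U) from

      pulled : ∃ λ R → L ↭ U ++ R
      pulled = pullToFront U L (unique ups) (λ e∈U → Cut.complete (upper-crossing e∈U))
      R = proj₁ pulled
      L↭UR = proj₂ pulled

      uniqR : Unique R
      uniqR = proj₁ (unique-++⁻ U (unique-↭ L↭UR Cut.unique))

      U∩R : ∀ {e} → e ∈ U → e ∉ R
      U∩R = proj₂ (unique-++⁻ U (unique-↭ L↭UR Cut.unique))

      R⊆L : ∀ {e} → e ∈ R → e ∈ L
      R⊆L e∈R = PermP.∈-resp-↭ (↭-sym L↭UR) (∈-++⁺ʳ U e∈R)

      W∩R : ∀ {e} → e ∈ W → e ∉ R
      W∩R e∈W e∈R = subst (Processed S) (sound lows e∈W) (proj₁ (Cut.sound (R⊆L e∈R))) ν∈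

      reordering = reorder L↭UR
      gadget = vertexGadget ν ups lows (trans (Enumeration.counted (upperEnum ν)) (proj₁ (arity ν)))
                                       (trans (Enumeration.counted (lowerEnum ν)) (proj₂ (arity ν))) R

      sound-next : ∀ {e} → e ∈ W ++ R → Crossing (S ∖ ν) e
      sound-next {e} e∈ with ∈-++⁻ W e∈
      ... | inj₁ e∈W = lowerEdge-crossing closed ν∈ e (sound lows e∈W)
      ... | inj₂ e∈R with Cut.sound (R⊆L e∈R)
      ...   | processed , pending =
        processed-∖ (upper e) processed , pending-∖ (lower e) pending (λ into → U∩R (complete ups into) e∈R)

      complete-next : ∀ {e} → Crossing (S ∖ ν) e → e ∈ W ++ R
      complete-next {e} (processed , pending) with pending-∖⁻ (lower e) pending | processed-∖⁻ (upper e) processed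
      ... | _ , _ | inj₁ from = ∈-++⁺ˡ (complete lows from)
      ... | pendingS , into≢ν | inj₂ processedS with ∈-++⁻ U (PermP.∈-resp-↭ L↭UR (Cut.complete (processedS , pendingS)))
      ...   | inj₁ e∈U = ⊥-elim (into≢ν (sound ups e∈U))
      ...   | inj₂ e∈R = ∈-++⁺ʳ W e∈R

  record Completion (S : Subset nV) (L : List Edge) : Set where
    field
      final      : List Edge
      derivation : LDeriv (frontier L) (labels L) (frontier final) (labels final)
      final-enum : Enumerates (λ e → lower e ≡ nothing) final
      fired      : Enumerates (_∈ₛ S) (vertices derivation)
      covers     : ∀ e → Crossing S e ⊎ Future S e → Occurs derivation e

  occurs-frontier : ∀ {L ψ τ} (d : LDeriv (frontier L) (labels L) ψ τ) {e} → e ∈ L → Occurs d e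
  occurs-frontier {L} d e∈L with labels-surjective L e∈L
  ... | p , refl = occurs-start d p

  -- When every vertex is processed, the crossing edges are exactly the ⊥-edges.
  finish : ∀ {S L} → ¬ Nonempty S → Enumerates (Crossing S) L → Completion S L
  finish {S} {L} empty crossing = record
    { final      = L
    ; derivation = done (λ _ → refl)
    ; final-enum = record { unique = unique ; sound = λ e∈ → toBottom _ (proj₂ (sound e∈))
                          ; complete = λ {e} low → complete (processed (upper e) , subst (Pending S) (sym low) tt) }
    ; fired      = record { unique = [] ; sound = λ () ; complete = λ μ∈ → ⊥-elim (empty (_ , μ∈)) }
    ; covers     = λ { e (inj₁ cross) → occurs-frontier (done (λ _ → refl)) (complete cross)
                     ; e (inj₂ (μ , _ , μ∈)) → ⊥-elim (empty (μ , μ∈)) } }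
    where
      open Enumerates crossing
      toBottom : ∀ m → Pending S m → m ≡ nothing
      toBottom nothing _ = refl
      toBottom (just κ) κ∈ = ⊥-elim (empty (κ , κ∈))
      processed : ∀ m → Processed S m
      processed nothing = tt
      processed (just μ) μ∈ = empty (μ , μ∈)

  extend : ∀ {S ν L} → UpClosed S → ν ∈ₛ S → Enumerates (Crossing S) L → (adv : Advance S ν L) →
           Completion (S ∖ ν) (Advance.next adv) → Completion S L
  extend {S} {ν} {L} closed ν∈ crossing adv rest = record
    { final      = final
    ; derivation = d
    ; final-enum = final-enum
    ; fired      = record { unique = subst Unique (sym fired≡) (All.tabulate ν-new ∷ unique fired)
                          ; sound = sound-fired ; complete = complete-fired }
    ; covers     = covers′ }
    where
      open Completion rest
      open Enumerates
      d₁ = proj₁ (Advance.step adv)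
      d = d₁ ⨟ derivation

      fired≡ : vertices d ≡ ν ∷ vertices derivation
      fired≡ = trans (vertices-⨟ d₁ derivation) (cong (_++ vertices derivation) (proj₂ (Advance.step adv)))

      ν-new : ∀ {μ} → μ ∈ vertices derivation → ν ≢ μ
      ν-new μ∈ refl = x∉p∖x ν (sound fired μ∈)

      sound-fired : ∀ {μ} → μ ∈ vertices d → μ ∈ₛ S
      sound-fired μ∈ with subst (_ ∈_) fired≡ μ∈
      ... | here refl = ν∈
      ... | there μ∈′ = proj₁ (∈-∖⁻ (sound fired μ∈′))

      complete-fired : ∀ {μ} → μ ∈ₛ S → μ ∈ vertices d
      complete-fired {μ} μ∈ with μ ≟ ν
      ... | yes refl = subst (μ ∈_) (sym fired≡) (here refl)
      ... | no μ≢ν = subst (μ ∈_) (sym fired≡) (there (complete fired (SubsetP.x∈p∧x≢y⇒x∈p-y μ∈ μ≢ν)))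

      covers′ : ∀ e → Crossing S e ⊎ Future S e → Occurs d e
      covers′ e (inj₁ cross) = occurs-frontier d (complete crossing cross)
      covers′ e (inj₂ (μ , from , μ∈)) with μ ≟ ν
      ... | yes refl = occurs-⨟ d₁ derivation (covers e (inj₁ (lowerEdge-crossing closed ν∈ e from)))
      ... | no μ≢ν = occurs-⨟ d₁ derivation (covers e (inj₂ (μ , from , SubsetP.x∈p∧x≢y⇒x∈p-y μ∈ μ≢ν)))

  -- Processing the vertices source by source; k bounds the number left.
  build : ∀ k {S L} → ∣ S ∣ ≤ k → UpClosed S → Enumerates (Crossing S) L → Completion S L
  build k {S} size closed crossing with SubsetP.nonempty? S
  ... | no empty = finish empty crossing
  ... | yes (μ , μ∈) with source S μ μ∈
  build zero size closed crossing | yes _ | ν , src =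
    ⊥-elim (ℕ.n≮0 (ℕ.<-≤-trans (SubsetP.x∈p⇒∣p-x∣<∣p∣ (proj₁ src)) size))
  build (suc k) size closed crossing | yes _ | ν , src =
    extend closed (proj₁ src) crossing adv
      (build k (ℕ.≤-pred (ℕ.<-≤-trans (SubsetP.x∈p⇒∣p-x∣<∣p∣ (proj₁ src)) size))
             (upClosed-∖ closed src) (Advance.next-crossing adv))
    where
      adv = advance closed src crossing

  topEnum : Enumeration {P = λ e → upper e ≡ nothing} (λ e → MaybeP.≡-dec _≟_ (upper e) nothing)
  topEnum = enumerate (λ e → MaybeP.≡-dec _≟_ (upper e) nothing)

  pending-full : ∀ m → Pending full m
  pending-full nothing = tt
  pending-full (just κ) = SubsetP.∈⊤

  initial-crossing : Enumerates (Crossing full) (Enumeration.list topEnum)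
  initial-crossing = record
    { unique   = unique
    ; sound    = λ {e} e∈ → subst (Processed full) (sym (sound e∈)) tt , pending-full (lower e)
    ; complete = λ {e} (processed , _) → complete (fromTop (upper e) processed) }
    where
      open Enumerates (Enumeration.enumerates topEnum)
      fromTop : ∀ m → Processed full m → m ≡ nothing
      fromTop nothing _ = refl
      fromTop (just μ) μ∉ = ⊥-elim (μ∉ SubsetP.∈⊤)

  everyEdge : ∀ e → Crossing full e ⊎ Future full e
  everyEdge e with upper e
  ... | nothing = inj₁ (tt , pending-full (lower e))
  ... | just μ = inj₂ (μ , refl , SubsetP.∈⊤)

  flowOfDerivation : IsFlowOfSomeDerivation A bar F
  flowOfDerivation =
    toDerivation derivation ,
    isFlowOf derivation (λ e → covers e (everyEdge e)) (unique fired) (λ μ → complete fired SubsetP.∈⊤)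
      (labels-bij (Enumeration.enumerates topEnum)) (labels-bij final-enum)
    where
      open Enumerates
      open Completion (build nV (ℕ.≤-reflexive (SubsetP.∣⊤∣≡n nV)) (λ _ _ _ _ → SubsetP.∈⊤) initial-crossing)

theorem3p8 : (A : Set) (bar : A → A) →
    (∀ a → bar (bar a) ≡ a) → (∀ a → bar a ≢ a) → A →
    (F : Flow) → IsAtomicFlow F → IsFlowOfSomeDerivation A bar F
theorem3p8 A bar bar-involutive _ a₀ F (arity , acyclic , π , polarised) =
  Construction.flowOfDerivation A bar bar-involutive a₀ F arity acyclic π polarised
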